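{- Let $p$ be a prime and $G=H\times P$ with $H\cong C_2^5$ and $P\cong C_p$. Let $\mathcal{A}$ be an S-ring over $G$ and $U$ an $\mathcal{A}$-subgroup with $U\ge P$. Suppose that $P$ is an $\mathcal{A}$-subgroup, $\mathcal{A}$ is the nontrivial $S$-wreath product where $S=U/P$, $|S|=16$, and $\mathcal{A}_{G/P}$ is a $2$-S-ring. Suppose moreover that $S$ does not have a gwr-complement with respect to $\mathcal{A}_{G/P}$. Then $|\mathrm{Aut}_{G/P}(\mathcal{A}_{G/P})^S|=|\mathrm{Aut}_{G/P}(\mathcal{A}_{G/P})|$.
   Context: For a finite group $G$ with identity $e$ and $X\subseteq G$ let $\underline{X}=\sum_{x\in X}x$. An S-ring over $G$ is a subring $\mathcal{A}\subseteq\mathbb{Z}G$ for which there is a partition $\mathcal{S}(\mathcal{A})$ of $G$ (basic sets) with $\{e\}\in\mathcal{S}(\mathcal{A})$, closed under inversion, and $\mathcal{A}=\mathrm{Span}_{\mathbb{Z}}\{\underline{X}:X\in\mathcal{S}(\mathcal{A})\}$. An $\mathcal{A}$-subgroup is a subgroup $K$ with $\underline K\in\mathcal{A}$; for $\mathcal{A}$-subgroups $L\trianglelefteq U$, $\mathcal{A}_{U/L}$ is the S-ring over $U/L$ spanned by the images of basic sets contained in $U$ under $U\to U/L$. A $2$-S-ring over a $2$-group is an S-ring with all basic sets of $2$-power size. $\mathrm{rad}(X)=\{g: gX=Xg=X\}$. $\mathcal{A}$ is the $U/L$-wreath product if $L\trianglelefteq G$ and $L\le\mathrm{rad}(X)$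 for every basic $X\not\subseteq U$; nontrivial if $L\ne\{e\}$, $U\ne G$. For an S-ring $\mathcal{B}$ over a group $G'$, a $\mathcal{B}$-subgroup $U'<G'$ has a gwr-complement with respect to $\mathcal{B}$ if there is a nontrivial normal $\mathcal{B}$-subgroup $L'\le U'$ such that $\mathcal{B}$ is the $U'/L'$-wreath product (here $S=U/P$ is viewed as a subgroup of $G/P$). $R(X)=\{(g,xg)\}$; $\mathrm{Aut}(\mathcal{B})$ is the group of permutations of $G'$ preserving each $R(X)$, $X$ basic; $\mathrm{Aut}_{G'}(\mathcal{B})=\mathrm{Aut}(\mathcal{B})\cap\mathrm{Aut}(G')$. For a set $\Delta$ of permutations of $G/P$, $\Delta^S=\{f|_S: f\in\Delta,\ S^f=S\}$ is the set of restrictions to $S$ of those elements leaving $S$ invariant. -}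

module Defs where

open import Data.Bool using (Bool; true; false; _xor_; _∧_; not)
open import Data.Nat using (ℕ; zero; suc; _+_; _*_; _∸_; _^_; NonZero)
open import Data.Nat.DivMod using (_mod_)
open import Data.Fin using (Fin; toℕ)
open import Data.Vec using (Vec; []; _∷_; zipWith; replicate)
open import Data.List using (List; []; _∷_; map; concatMap; allFin; filterᵇ; length)
open import Data.Bool.ListAction using (any)
open import Data.Product using (Σ; ∃; ∃-syntax; _×_; _,_; proj₁)
open import Relation.Binary.PropositionalEquality using (_≡_; _≢_; setoid)
import Relation.Binary.PropositionalEquality
open import Relation.Binary.Bundles using (Setoid)
open import Function.Bundles using (_↔_; Inverse)

H : Set
H = Vec Bool 5

_⊕_ : H → H → H
_⊕_ = zipWith _xor_

0H : H
0H = replicate 5 false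

isZero : ∀ {n} → Vec Bool n → Bool
isZero []         = true
isZero (b ∷ bs)   = not b ∧ isZero bs

allVecs : (n : ℕ) → List (Vec Bool n)
allVecs zero    = [] ∷ []
allVecs (suc n) = concatMap (λ v → (false ∷ v) ∷ (true ∷ v) ∷ []) (allVecs n)

allH : List H
allH = allVecs 5

count : {A : Set} → List A → (A → Bool) → ℕ
count xs X = length (filterᵇ X xs)

countH : (H → Bool) → ℕ
countH X = count allH X

module _ (p : ℕ) .{{_ : NonZero p}} where

  _+ₚ_ : Fin p → Fin p → Fin p
  a +ₚ b = (toℕ a + toℕ b) mod p

  -ₚ_ : Fin p → Fin p
  -ₚ a = (p ∸ toℕ a) mod p

  0ₚ : Fin p
  0ₚ = 0 mod p

  G : Set
  G = H × Fin p

  _·_ : G → G → G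
  (h , a) · (h' , a') = (h ⊕ h') , (a +ₚ a')

  inv : G → G
  inv (h , a) = h , (-ₚ a)

  e : G
  e = 0H , 0ₚ

  allG : List G
  allG = concatMap (λ h → map (λ a → h , a) (allFin p)) allH

  countG : (G → Bool) → ℕ
  countG X = count allG X

  Pset : G → Bool
  Pset (h , a) = isZero h

  -- The partition S(A) into basic sets is given by a
  -- Boolean equivalence relation _~_; the basic set containing g is
  -- cls g = {x | x ~ g}.  A = Span_Z {X̲ : X basic} is a subring of ZG
  -- iff e ∈ A (ensured by {e} being basic) and, for basic X, Y, the
  -- coefficient of z in X̲·Y̲, namely #{x ∈ X | x⁻¹z ∈ Y}, is constant
  -- on every basic set.

  module _ (_~_ : G → G → Bool) where

    cls : G → G → Bool
    cls g x = x ~ g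

    structConst : G → G → G → ℕ
    structConst x y z = countG (λ u → (u ~ x) ∧ ((inv u · z) ~ y))

    record IsSRing : Set where
      field
        ~-refl   : ∀ x → x ~ x ≡ true
        ~-sym    : ∀ x y → x ~ y ≡ true → y ~ x ≡ true
        ~-trans  : ∀ x y z → x ~ y ≡ true → y ~ z ≡ true → x ~ z ≡ true
        e-basic  : ∀ x → x ~ e ≡ true → x ≡ e
        -- X basic ⇒ X⁻¹ basic
        inv-closed : ∀ g → ∃[ g' ] (∀ x → inv x ~ g ≡ x ~ g')
        mult-closed : ∀ x y z z' → z ~ z' ≡ true →
                      structConst x y z ≡ structConst x y z'

    record IsASubgroup (K : G → Bool) : Set where
      field
        e∈     : K e ≡ true
        ·-closed   : ∀ x y → K x ≡ true → K y ≡ true → K (x · y) ≡ true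
        inv-closedK : ∀ x → K x ≡ true → K (inv x) ≡ true
        union  : ∀ x y → x ~ y ≡ true → K x ≡ K y

    -- L ≤ rad(X) for every basic X ⊄ U   (L ⊴ G is automatic: G abelian)
    IsWreath : (U L : G → Bool) → Set
    IsWreath U L =
      ∀ g → (∃[ x ] (x ~ g ≡ true × U x ≡ false)) →
      ∀ l → L l ≡ true → ∀ x →
        ((l · x) ~ g ≡ x ~ g) × ((x · l) ~ g ≡ x ~ g)

    -- The quotient S-ring B = A_{G/P}, with G/P identified with H via
    -- the projection (h , a) ↦ h.  Its basic sets are the images
    -- qcls g = π(cls g) of the basic sets of A (g ∈ G).

    qcls : G → H → Bool
    qcls g h = any (λ a → (h , a) ~ g) (allFin p)

    quotSet : (G → Bool) → H → Bool
    quotSet U h = any (λ a → U (h , a)) (allFin p)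

    Is2SRing : Set
    Is2SRing = ∀ g → ∃[ k ] (countH (qcls g) ≡ 2 ^ k)

    -- B-subgroup of H (inverses: x⁻¹ = x in C₂⁵)
    record IsBSubgroup (L : H → Bool) : Set where
      field
        0∈      : L 0H ≡ true
        ⊕-closed : ∀ x y → L x ≡ true → L y ≡ true → L (x ⊕ y) ≡ true
        union   : ∀ g x y → qcls g x ≡ true → qcls g y ≡ true → L x ≡ L y

    -- S has a gwr-complement w.r.t. B: there is a nontrivial (normal,
    -- automatic since H is abelian) B-subgroup L' ≤ S such that B is the
    -- S/L'-wreath product.
    HasGwrComplement : (H → Bool) → Set
    HasGwrComplement S =
      Σ (H → Bool) λ L →
        IsBSubgroup L ×
        (∃[ h ] (L h ≡ true × isZero h ≡ false)) ×
        (∀ h → L h ≡ true → S h ≡ true) ×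
        (∀ g → (∃[ h ] (qcls g h ≡ true × S h ≡ false)) →
          ∀ l → L l ≡ true → ∀ h →
            (qcls g (l ⊕ h) ≡ qcls g h) × (qcls g (h ⊕ l) ≡ qcls g h))

    -- Aut_{G/P}(B): permutations of H that are group automorphisms and
    -- preserve every R(T) = {(u , x u) | x ∈ T}, T basic in B.

    InR : (H → Bool) → H → H → Set
    InR T u v = ∃[ x ] (T x ≡ true × v ≡ x ⊕ u)

    record AutB : Set where
      field
        σ     : H ↔ H
      open Inverse σ public using (to; from)
      field
        hom   : ∀ x y → to (x ⊕ y) ≡ to x ⊕ to y
        presR : ∀ g u v → (InR (qcls g) u v → InR (qcls g) (to u) (to v))
                        × (InR (qcls g) (to u) (to v) → InR (qcls g) u v)

    AutBSetoid : Setoid _ _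
    AutBSetoid = record
      { Carrier = AutB
      ; _≈_ = λ f f' → ∀ x → AutB.to f x ≡ AutB.to f' x
      ; isEquivalence = record
        { refl  = λ x → Relation.Binary.PropositionalEquality.refl
        ; sym   = λ eq x → Relation.Binary.PropositionalEquality.sym (eq x)
        ; trans = λ e1 e2 x → Relation.Binary.PropositionalEquality.trans (e1 x) (e2 x) } }

    -- Δ^S: restrictions to S of the elements f ∈ Δ with S^f = S; two such
    -- restrictions are equal iff they agree on S.
    AutBRestrSetoid : (H → Bool) → Setoid _ _
    AutBRestrSetoid S = record
      { Carrier = Σ AutB (λ f → ∀ h → S (AutB.to f h) ≡ S h)
      ; _≈_ = λ f f' → ∀ x → S x ≡ true → AutB.to (proj₁ f) x ≡ AutB.to (proj₁ f') x
      ; isEquivalence = record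
        { refl  = λ x _ → Relation.Binary.PropositionalEquality.refl
        ; sym   = λ eq x s → Relation.Binary.PropositionalEquality.sym (eq x s)
        ; trans = λ e1 e2 x s → Relation.Binary.PropositionalEquality.trans (e1 x s) (e2 x s) } }

{-# OPTIONS --safe #-}
module Submission where

-- Automorphisms of B = A_{G/P} fix every basic set of B, hence also S = U/P, which is a union of
-- basic sets; so restriction to S is well defined and onto, and the point is injectivity.
-- As |S| = 16, S has index 2 in G/P ≅ C₂⁵. If f and f′ agree on S, then t = f x ⊕ f′ x is one
-- and the same element of S for all x ∉ S, and t lies in the radical of every basic set of B
-- outside S. The elements of S with this property form a B-subgroup L; that L is a union of basic
-- sets is read off the structure constants of A, using that the basic sets of A outside U are
-- unions of P-cosets. A nontrivial L would be a gwr-complement of S, so t = 0 and f = f′.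

open import Defs
open import Algebra.Properties.CommutativeSemigroup using (interchange)
open import Data.Bool using (Bool; true; false; _xor_; _∧_; _∨_; T?; _≟_)
open import Data.Bool.Properties using (xor-same; xor-assoc; xor-comm; xor-identityˡ; xor-identityʳ; T-≡; ⇔→≡)
open import Data.Bool.ListAction using (any)
open import Data.Empty using (⊥; ⊥-elim)
open import Data.Fin using (Fin; toℕ)
open import Data.Fin.Properties using (toℕ-injective; toℕ-fromℕ<; toℕ<n; toℕ≤n)
open import Data.List using (List; []; _∷_; length; concatMap; map; allFin)
open import Data.List.Membership.Propositional using (_∈_; lose; find)
open import Data.List.Membership.Propositional.Properties using (∈-concatMap⁺; ∈-map⁺; ∈-allFin)
open import Data.List.Properties using (length-filter)
open import Data.List.Relation.Unary.All as All using (All)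
open import Data.List.Relation.Unary.Any as Any using (here; there)
open import Data.List.Relation.Unary.Any.Properties using (any⁺; any⁻)
open import Data.Nat using (ℕ; zero; suc; _+_; _*_; _∸_; _%_; _≤_; _<_; _<?_; z≤n; s≤s; NonZero)
open import Data.Nat.DivMod using (_mod_; %-distribˡ-+; [m+n]%n≡m%n; m<n⇒m%n≡m)
open import Data.Nat.Primality using (Prime)
open import Data.Nat.Properties
  using (+-suc; +-comm; +-assoc; +-commutativeSemigroup; m≤n⇒m≤1+n; suc-injective; <⇒≱; ≤-reflexive; m∸n+n≡m)
open import Data.Nat.Tactic.RingSolver using (solve-∀)
open import Data.Product using (∃-syntax; _×_; _,_; proj₁; proj₂)
open import Data.Vec using (Vec; []; _∷_; zipWith; replicate)
open import Data.Vec.Properties using (zipWith-comm; zipWith-assoc; zipWith-identityˡ; zipWith-identityʳ)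
open import Function using (_∘_)
open import Function.Bundles using (Bijection; Equivalence; Inverse; mk⇔)
open import Relation.Binary.PropositionalEquality
open import Relation.Nullary using (¬_)
open import Relation.Nullary.Decidable using (Dec; ⌊_⌋; map′; toWitness; fromWitness; from-yes; _×-dec_; _→-dec_)

infixl 6 _⊕ᵥ_

_⊕ᵥ_ : ∀ {n} → Vec Bool n → Vec Bool n → Vec Bool n
_⊕ᵥ_ = zipWith _xor_

⊕ᵥ-comm : ∀ {n} (x y : Vec Bool n) → x ⊕ᵥ y ≡ y ⊕ᵥ x
⊕ᵥ-comm = zipWith-comm xor-comm

⊕ᵥ-assoc : ∀ {n} (x y z : Vec Bool n) → (x ⊕ᵥ y) ⊕ᵥ z ≡ x ⊕ᵥ (y ⊕ᵥ z)
⊕ᵥ-assoc = zipWith-assoc xor-assoc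

⊕ᵥ-identityˡ : ∀ {n} (x : Vec Bool n) → replicate n false ⊕ᵥ x ≡ x
⊕ᵥ-identityˡ = zipWith-identityˡ xor-identityˡ

⊕ᵥ-identityʳ : ∀ {n} (x : Vec Bool n) → x ⊕ᵥ replicate n false ≡ x
⊕ᵥ-identityʳ = zipWith-identityʳ xor-identityʳ

⊕ᵥ-self : ∀ {n} (x : Vec Bool n) → x ⊕ᵥ x ≡ replicate n false
⊕ᵥ-self []      = refl
⊕ᵥ-self (b ∷ x) = cong₂ _∷_ (xor-same b) (⊕ᵥ-self x)

⊕ᵥ-cancelˡ : ∀ {n} (x y : Vec Bool n) → x ⊕ᵥ (x ⊕ᵥ y) ≡ y
⊕ᵥ-cancelˡ x y = begin
  x ⊕ᵥ (x ⊕ᵥ y)           ≡⟨ ⊕ᵥ-assoc x x y ⟨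
  (x ⊕ᵥ x) ⊕ᵥ y           ≡⟨ cong (_⊕ᵥ y) (⊕ᵥ-self x) ⟩
  replicate _ false ⊕ᵥ y  ≡⟨ ⊕ᵥ-identityˡ y ⟩
  y                       ∎
  where open ≡-Reasoning

⊕ᵥ-cancelʳ : ∀ {n} (x y : Vec Bool n) → (y ⊕ᵥ x) ⊕ᵥ x ≡ y
⊕ᵥ-cancelʳ x y = begin
  (y ⊕ᵥ x) ⊕ᵥ x           ≡⟨ ⊕ᵥ-assoc y x x ⟩
  y ⊕ᵥ (x ⊕ᵥ x)           ≡⟨ cong (y ⊕ᵥ_) (⊕ᵥ-self x) ⟩
  y ⊕ᵥ replicate _ false  ≡⟨ ⊕ᵥ-identityʳ y ⟩
  y                       ∎
  where open ≡-Reasoning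

⊕ᵥ-cancel-shared : ∀ {n} (x y z : Vec Bool n) → (x ⊕ᵥ z) ⊕ᵥ (y ⊕ᵥ z) ≡ x ⊕ᵥ y
⊕ᵥ-cancel-shared x y z = begin
  (x ⊕ᵥ z) ⊕ᵥ (y ⊕ᵥ z)  ≡⟨ cong ((x ⊕ᵥ z) ⊕ᵥ_) (⊕ᵥ-comm y z) ⟩
  (x ⊕ᵥ z) ⊕ᵥ (z ⊕ᵥ y)  ≡⟨ ⊕ᵥ-assoc x z (z ⊕ᵥ y) ⟩
  x ⊕ᵥ (z ⊕ᵥ (z ⊕ᵥ y))  ≡⟨ cong (x ⊕ᵥ_) (⊕ᵥ-cancelˡ z y) ⟩
  x ⊕ᵥ y                ∎
  where open ≡-Reasoning

⊕ᵥ-≡0⇒≡ : ∀ {n} (x y : Vec Bool n) → x ⊕ᵥ y ≡ replicate n false → x ≡ y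
⊕ᵥ-≡0⇒≡ x y x⊕y≡0 = begin
  x                       ≡⟨ ⊕ᵥ-identityʳ x ⟨
  x ⊕ᵥ replicate _ false  ≡⟨ cong (x ⊕ᵥ_) x⊕y≡0 ⟨
  x ⊕ᵥ (x ⊕ᵥ y)           ≡⟨ ⊕ᵥ-cancelˡ x y ⟩
  y                       ∎
  where open ≡-Reasoning

isZero⇒≡0 : ∀ {n} (v : Vec Bool n) → isZero v ≡ true → v ≡ replicate n false
isZero⇒≡0 []          _  = refl
isZero⇒≡0 (false ∷ v) eq = cong (false ∷_) (isZero⇒≡0 v eq)

indicator : Bool → ℕ
indicator true  = 1
indicator false = 0

module _ {A : Set} where

  count-∧-≤ : ∀ (xs : List A) (X Y : A → Bool) → count xs (λ x → X x ∧ Y x) ≤ count xs X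
  count-∧-≤ []       X Y = z≤n
  count-∧-≤ (x ∷ xs) X Y with X x | Y x
  ... | true  | true  = s≤s (count-∧-≤ xs X Y)
  ... | true  | false = m≤n⇒m≤1+n (count-∧-≤ xs X Y)
  ... | false | _     = count-∧-≤ xs X Y

  count-∧-≡ : ∀ (xs : List A) (X Y : A → Bool) → (∀ x → X x ≡ true → Y x ≡ true) →
              count xs (λ x → X x ∧ Y x) ≡ count xs X
  count-∧-≡ []       X Y X⊆Y = refl
  count-∧-≡ (x ∷ xs) X Y X⊆Y with X x in Xx
  ... | true  rewrite X⊆Y x Xx = cong suc (count-∧-≡ xs X Y X⊆Y)
  ... | false = count-∧-≡ xs X Y X⊆Y

  count-∧-≡⁻ : ∀ (xs : List A) (X Y : A → Bool) → count xs (λ x → X x ∧ Y x) ≡ count xs X →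
               ∀ {x} → x ∈ xs → X x ≡ true → Y x ≡ true
  count-∧-≡⁻ (y ∷ xs) X Y eq x∈ Xx with X y in Xy | Y y in Yy | x∈
  ... | true  | true  | here refl = Yy
  ... | true  | true  | there x∈′ = count-∧-≡⁻ xs X Y (suc-injective eq) x∈′ Xx
  ... | true  | false | _ = ⊥-elim (<⇒≱ (s≤s (count-∧-≤ xs X Y)) (≤-reflexive (sym eq)))
  ... | false | _     | here refl with () ← trans (sym Xx) Xy
  ... | false | _     | there x∈′ = count-∧-≡⁻ xs X Y eq x∈′ Xx

  count-cong : ∀ (xs : List A) (X Y : A → Bool) → (∀ x → X x ≡ Y x) → count xs X ≡ count xs Y
  count-cong []       X Y X≗Y = refl
  count-cong (x ∷ xs) X Y X≗Y with X x | Y x | X≗Y x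
  ... | true  | .true  | refl = cong suc (count-cong xs X Y X≗Y)
  ... | false | .false | refl = count-cong xs X Y X≗Y

  count-∷ : ∀ x (xs : List A) (X : A → Bool) → count (x ∷ xs) X ≡ indicator (X x) + count xs X
  count-∷ x xs X with X x
  ... | true  = refl
  ... | false = refl

  count-∨ : ∀ (xs : List A) (X Y : A → Bool) → (∀ x → X x ≡ true → Y x ≡ true → ⊥) →
            count xs (λ x → X x ∨ Y x) ≡ count xs X + count xs Y
  count-∨ []       X Y disj = refl
  count-∨ (x ∷ xs) X Y disj with X x | Y x | disj x
  ... | true  | true  | X∩Y = ⊥-elim (X∩Y refl refl)
  ... | true  | false | _   = cong suc (count-∨ xs X Y disj)
  ... | false | true  | _   = trans (cong suc (count-∨ xs X Y disj)) (sym (+-suc _ _))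
  ... | false | false | _   = count-∨ xs X Y disj

count-allVecs-suc : ∀ n (X : Vec Bool (suc n) → Bool) →
  count (allVecs (suc n)) X ≡ count (allVecs n) (X ∘ (false ∷_)) + count (allVecs n) (X ∘ (true ∷_))
count-allVecs-suc n X = go (allVecs n)
  where
    pairs : List (Vec Bool n) → List (Vec Bool (suc n))
    pairs = concatMap (λ v → (false ∷ v) ∷ (true ∷ v) ∷ [])

    go : ∀ vs → count (pairs vs) X ≡ count vs (X ∘ (false ∷_)) + count vs (X ∘ (true ∷_))
    go []       = refl
    go (v ∷ vs) = begin
      count ((false ∷ v) ∷ (true ∷ v) ∷ pairs vs) X ≡⟨ count-∷ (false ∷ v) _ X ⟩
      i₀ + count ((true ∷ v) ∷ pairs vs) X          ≡⟨ cong (i₀ +_) (count-∷ (true ∷ v) _ X) ⟩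
      i₀ + (i₁ + count (pairs vs) X)                ≡⟨ cong (λ c → i₀ + (i₁ + c)) (go vs) ⟩
      i₀ + (i₁ + (c₀ + c₁))                         ≡⟨ +-assoc i₀ i₁ (c₀ + c₁) ⟨
      (i₀ + i₁) + (c₀ + c₁)                         ≡⟨ interchange +-commutativeSemigroup i₀ i₁ c₀ c₁ ⟩
      (i₀ + c₀) + (i₁ + c₁)                         ≡⟨ cong₂ _+_ (count-∷ v vs (X ∘ (false ∷_))) (count-∷ v vs (X ∘ (true ∷_))) ⟨
      count (v ∷ vs) (X ∘ (false ∷_)) + count (v ∷ vs) (X ∘ (true ∷_)) ∎
      where
        open ≡-Reasoning
        i₀ = indicator (X (false ∷ v))
        i₁ = indicator (X (true ∷ v))
        c₀ = count vs (X ∘ (false ∷_))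
        c₁ = count vs (X ∘ (true ∷_))

count-allVecs-translate : ∀ n (a : Vec Bool n) (X : Vec Bool n → Bool) →
  count (allVecs n) (λ v → X (a ⊕ᵥ v)) ≡ count (allVecs n) X
count-allVecs-translate zero    []      X = count-cong (allVecs 0) (λ v → X ([] ⊕ᵥ v)) X (λ { [] → refl })
count-allVecs-translate (suc n) (b ∷ a) X = begin
  count (allVecs (suc n)) (λ v → X ((b ∷ a) ⊕ᵥ v))
    ≡⟨ count-allVecs-suc n (λ v → X ((b ∷ a) ⊕ᵥ v)) ⟩
  count (allVecs n) (λ v → X ((b xor false) ∷ a ⊕ᵥ v)) + count (allVecs n) (λ v → X ((b xor true) ∷ a ⊕ᵥ v))
    ≡⟨ cong₂ _+_ (count-allVecs-translate n a (X ∘ ((b xor false) ∷_))) (count-allVecs-translate n a (X ∘ ((b xor true) ∷_))) ⟩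
  count (allVecs n) (X ∘ ((b xor false) ∷_)) + count (allVecs n) (X ∘ ((b xor true) ∷_))
    ≡⟨ swap b ⟩
  count (allVecs n) (X ∘ (false ∷_)) + count (allVecs n) (X ∘ (true ∷_))
    ≡⟨ count-allVecs-suc n X ⟨
  count (allVecs (suc n)) X ∎
  where
    open ≡-Reasoning
    swap : ∀ b → count (allVecs n) (X ∘ ((b xor false) ∷_)) + count (allVecs n) (X ∘ ((b xor true) ∷_)) ≡
                 count (allVecs n) (X ∘ (false ∷_)) + count (allVecs n) (X ∘ (true ∷_))
    swap false = refl
    swap true  = +-comm (count (allVecs n) (X ∘ (true ∷_))) (count (allVecs n) (X ∘ (false ∷_)))

∈-allVecs : ∀ {n} (v : Vec Bool n) → v ∈ allVecs n
∈-allVecs []      = here refl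
∈-allVecs (b ∷ v) = ∈-concatMap⁺ _ (Any.map (λ { refl → head-∈ b }) (∈-allVecs v))
  where
    head-∈ : ∀ b → (b ∷ v) ∈ (false ∷ v) ∷ (true ∷ v) ∷ []
    head-∈ false = here refl
    head-∈ true  = there (here refl)

-- Otherwise S, a ⊕ S and b ⊕ S would be three disjoint cosets.
index-two : ∀ {n} (S : Vec Bool n → Bool) →
  (∀ {x y} → S x ≡ true → S y ≡ true → S (x ⊕ᵥ y) ≡ true) →
  length (allVecs n) < 3 * count (allVecs n) S →
  ∀ {a b} → S a ≡ false → S b ≡ false → S (a ⊕ᵥ b) ≡ true
index-two {n} S closed large {a} {b} a∉S b∉S with S (a ⊕ᵥ b) in ab∉S
... | true  = refl
... | false = ⊥-elim (<⇒≱ large (subst (_≤ length (allVecs n)) three-cosets (length-filter (T? ∘ S∪aS∪bS) (allVecs n))))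
  where
    S∪aS : Vec Bool n → Bool
    S∪aS h = S h ∨ S (a ⊕ᵥ h)

    S∪aS∪bS : Vec Bool n → Bool
    S∪aS∪bS h = S∪aS h ∨ S (b ⊕ᵥ h)

    not-both : ∀ {x y} → S x ≡ true → S y ≡ true → S (x ⊕ᵥ y) ≡ false → ⊥
    not-both x∈S y∈S xy∉S with () ← trans (sym (closed x∈S y∈S)) xy∉S

    outside-coset : ∀ {c} → S c ≡ false → ∀ h → S h ≡ true → S (c ⊕ᵥ h) ≡ true → ⊥
    outside-coset {c} c∉S h h∈S ch∈S = not-both ch∈S h∈S (subst (λ z → S z ≡ false) (sym (⊕ᵥ-cancelʳ h c)) c∉S)

    aS∩bS : ∀ h → S (a ⊕ᵥ h) ≡ true → S (b ⊕ᵥ h) ≡ true → ⊥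
    aS∩bS h ah∈S bh∈S = not-both ah∈S bh∈S (subst (λ z → S z ≡ false) (sym (⊕ᵥ-cancel-shared a b h)) ab∉S)

    S∪aS∩bS : ∀ h → S∪aS h ≡ true → S (b ⊕ᵥ h) ≡ true → ⊥
    S∪aS∩bS h h∈S∪aS with S h in h∈S | S (a ⊕ᵥ h) in ah∈S
    ... | true  | _    = outside-coset b∉S h h∈S
    ... | false | true = aS∩bS h ah∈S

    coset-size : ∀ c → count (allVecs n) (λ h → S (c ⊕ᵥ h)) ≡ count (allVecs n) S
    coset-size c = count-allVecs-translate n c S

    three-cosets : count (allVecs n) S∪aS∪bS ≡ 3 * count (allVecs n) S
    three-cosets = begin
      count (allVecs n) S∪aS∪bS                        ≡⟨ count-∨ (allVecs n) S∪aS _ S∪aS∩bS ⟩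
      count (allVecs n) S∪aS + count (allVecs n) (λ h → S (b ⊕ᵥ h))
        ≡⟨ cong₂ _+_ (count-∨ (allVecs n) S _ (outside-coset a∉S)) (coset-size b) ⟩
      (count (allVecs n) S + count (allVecs n) (λ h → S (a ⊕ᵥ h))) + count (allVecs n) S
        ≡⟨ cong (λ c → (count (allVecs n) S + c) + count (allVecs n) S) (coset-size a) ⟩
      (count (allVecs n) S + count (allVecs n) S) + count (allVecs n) S
        ≡⟨ thrice (count (allVecs n) S) ⟩
      3 * count (allVecs n) S ∎
      where
        open ≡-Reasoning
        thrice : ∀ c → (c + c) + c ≡ 3 * c
        thrice = solve-∀

module _ (p : ℕ) .{{_ : NonZero p}} where

  ∈-allG : ∀ (g : G p) → g ∈ allG p
  ∈-allG (h , a) = ∈-concatMap⁺ (λ h → map (h ,_) (allFin p)) (Any.map (λ { refl → ∈-map⁺ (h ,_) (∈-allFin a) }) (∈-allVecs h))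

  +ₚ-solveˡ : ∀ (c a : Fin p) → ∃[ d ] (_+ₚ_ p d c ≡ a)
  +ₚ-solveˡ c a = x mod p , toℕ-injective (begin
    toℕ ((toℕ (x mod p) + toℕ c) mod p)  ≡⟨ toℕ-fromℕ< _ ⟩
    (toℕ (x mod p) + toℕ c) % p          ≡⟨ cong (λ w → (w + toℕ c) % p) (toℕ-fromℕ< _) ⟩
    (x % p + toℕ c) % p                  ≡⟨ cong (λ w → (x % p + w) % p) (m<n⇒m%n≡m (toℕ<n c)) ⟨
    (x % p + toℕ c % p) % p              ≡⟨ %-distribˡ-+ x (toℕ c) p ⟨
    (x + toℕ c) % p                      ≡⟨ cong (_% p) (+-assoc (toℕ a) (p ∸ toℕ c) (toℕ c)) ⟩
    (toℕ a + (p ∸ toℕ c + toℕ c)) % p    ≡⟨ cong (λ w → (toℕ a + w) % p) (m∸n+n≡m (toℕ≤n c)) ⟩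
    (toℕ a + p) % p                      ≡⟨ [m+n]%n≡m%n (toℕ a) p ⟩
    toℕ a % p                            ≡⟨ m<n⇒m%n≡m (toℕ<n a) ⟩
    toℕ a                                ∎)
    where
      open ≡-Reasoning
      x = toℕ a + (p ∸ toℕ c)

  fibre-transitive : ∀ (h : H) (c a : Fin p) → ∃[ d ] (_·_ p (0H , d) (h , c) ≡ (h , a))
  fibre-transitive h c a with +ₚ-solveˡ c a
  ... | d , d+c≡a = d , cong₂ _,_ (⊕ᵥ-identityˡ h) d+c≡a

module WreathQuotient
  (p : ℕ) .{{_ : NonZero p}}
  (_~_ : G p → G p → Bool) (isSRing : IsSRing p _~_)
  (U : G p → Bool) (U-sub : IsASubgroup p _~_ U)
  (P⊆U : ∀ g → Pset p g ≡ true → U g ≡ true)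
  (wreath : IsWreath p _~_ U (Pset p))
  where

  open IsSRing isSRing
  open IsASubgroup U-sub using (e∈; ·-closed) renaming (union to U-union)

  S : H → Bool
  S = quotSet p _~_ U

  X : G p → H → Bool
  X = qcls p _~_

  infixl 7 _∙_
  _∙_ : G p → G p → G p
  _∙_ = _·_ p

  quotSet⁺ : ∀ (V : G p → Bool) {h} a → V (h , a) ≡ true → quotSet p _~_ V h ≡ true
  quotSet⁺ V a Vha = Equivalence.to T-≡ (any⁺ _ (lose (∈-allFin a) (Equivalence.from T-≡ Vha)))

  quotSet⁻ : ∀ (V : G p → Bool) {h} → quotSet p _~_ V h ≡ true → ∃[ a ] (V (h , a) ≡ true)
  quotSet⁻ V eq with find (any⁻ _ (allFin p) (Equivalence.from T-≡ eq))
  ... | a , _ , Vha = a , Equivalence.to T-≡ Vha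

  U-fibre : ∀ {h} c a → U (h , c) ≡ true → U (h , a) ≡ true
  U-fibre {h} c a hc∈U with fibre-transitive p h c a
  ... | d , dhc≡ha = subst (λ z → U z ≡ true) dhc≡ha (·-closed (0H , d) (h , c) (P⊆U (0H , d) refl) hc∈U)

  S-false⇒U-false : ∀ {h} → S h ≡ false → ∀ a → U (h , a) ≡ false
  S-false⇒U-false {h} h∉S a with U (h , a) in ha∈U
  ... | false = refl
  ... | true with () ← trans (sym (quotSet⁺ U a ha∈U)) h∉S

  S-0 : S 0H ≡ true
  S-0 = quotSet⁺ U (0ₚ p) e∈

  S-closed : ∀ {x y} → S x ≡ true → S y ≡ true → S (x ⊕ y) ≡ true
  S-closed {x} {y} x∈S y∈S with quotSet⁻ U x∈S | quotSet⁻ U y∈S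
  ... | a , xa∈U | b , yb∈U = quotSet⁺ U _ (·-closed (x , a) (y , b) xa∈U yb∈U)

  S-classwise : ∀ {g x y} → X g x ≡ true → X g y ≡ true → S x ≡ true → S y ≡ true
  S-classwise {g} {x} {y} x∈Xg y∈Xg x∈S
    with quotSet⁻ (_~ g) x∈Xg | quotSet⁻ (_~ g) y∈Xg | quotSet⁻ U x∈S
  ... | a , xa~g | b , yb~g | c , xc∈U =
    quotSet⁺ U b (trans (trans (U-union (y , b) g yb~g) (sym (U-union (x , a) g xa~g))) (U-fibre c a xc∈U))

  own-class : ∀ h a → X (h , a) h ≡ true
  own-class h a = quotSet⁺ (_~ (h , a)) a (~-refl (h , a))

  S-false-classwise : ∀ {g h₀ h} → X g h₀ ≡ true → S h₀ ≡ false → X g h ≡ true → S h ≡ false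
  S-false-classwise {h = h} h₀∈Xg h₀∉S h∈Xg with S h in h∈S
  ... | false = refl
  ... | true with () ← trans (sym (S-classwise h∈Xg h₀∈Xg h∈S)) h₀∉S

  -- The basic sets of A outside U are unions of P-cosets: the only use of the wreath hypothesis.
  outer-lift : ∀ {g h₀ h} → X g h₀ ≡ true → S h₀ ≡ false → X g h ≡ true → ∀ c → (h , c) ~ g ≡ true
  outer-lift {g} {h₀} {h} h₀∈Xg h₀∉S h∈Xg c
    with quotSet⁻ (_~ g) h₀∈Xg | quotSet⁻ (_~ g) h∈Xg
  ... | b , h₀b~g | d , hd~g with fibre-transitive p h d c
  ...   | d′ , d′hd≡hc =
    subst (λ z → z ~ g ≡ true) d′hd≡hc
      (trans (proj₁ (wreath g ((h₀ , b) , h₀b~g , S-false⇒U-false h₀∉S b) (0H , d′) refl (h , d))) hd~g)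

  -- v ∈ rad(X) for every basic set X of B outside S (v ⊕ X ⊆ X suffices, X being finite);
  -- outerRadical below is S ∩ ⋂ rad(X), the candidate gwr-complement.
  InOuterRadical : H → Set
  InOuterRadical v = ∀ g h → X g h ≡ true → S h ≡ false → X g (v ⊕ h) ≡ true

  inOuterRadical? : ∀ v → Dec (InOuterRadical v)
  inOuterRadical? v =
    map′ (λ r g h → All.lookup (All.lookup r (∈-allG p g)) (∈-allVecs h))
         (λ r → All.tabulate λ {g} _ → All.tabulate λ {h} _ → r g h)
         (All.all? (λ g → All.all? (λ h → (X g h ≟ true) →-dec (S h ≟ false) →-dec (X g (v ⊕ h) ≟ true)) allH) (allG p))

  outerRadical : H → Bool
  outerRadical v = ⌊ (S v ≟ true) ×-dec inOuterRadical? v ⌋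

  outerRadical⁺ : ∀ {v} → S v ≡ true → InOuterRadical v → outerRadical v ≡ true
  outerRadical⁺ v∈S v∈R = Equivalence.to T-≡ (fromWitness (v∈S , v∈R))

  outerRadical⁻ : ∀ {v} → outerRadical v ≡ true → S v ≡ true × InOuterRadical v
  outerRadical⁻ eq = toWitness (Equivalence.from T-≡ eq)

  inOuterRadical-0 : InOuterRadical 0H
  inOuterRadical-0 g h h∈Xg _ = subst (λ z → X g z ≡ true) (sym (⊕ᵥ-identityˡ h)) h∈Xg

  inOuterRadical-⊕ : ∀ {v w} → InOuterRadical v → InOuterRadical w → InOuterRadical (v ⊕ w)
  inOuterRadical-⊕ {v} {w} v∈R w∈R g h h∈Xg h∉S =
    subst (λ z → X g z ≡ true) (sym (⊕ᵥ-assoc v w h))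
      (v∈R g (w ⊕ h) wh∈Xg (S-false-classwise h∈Xg h∉S wh∈Xg))
    where
      wh∈Xg : X g (w ⊕ h) ≡ true
      wh∈Xg = w∈R g h h∈Xg h∉S

  inOuterRadical-invariant : ∀ {l g h₀} → InOuterRadical l → X g h₀ ≡ true → S h₀ ≡ false →
                             ∀ h → X g (l ⊕ h) ≡ X g h
  inOuterRadical-invariant {l} {g} l∈R h₀∈Xg h₀∉S h = ⇔→≡ (mk⇔ from-lh to-lh)
    where
      from-lh : X g (l ⊕ h) ≡ true → X g h ≡ true
      from-lh lh∈Xg = subst (λ z → X g z ≡ true) (⊕ᵥ-cancelˡ l h)
        (l∈R g (l ⊕ h) lh∈Xg (S-false-classwise h₀∈Xg h₀∉S lh∈Xg))
      to-lh : X g h ≡ true → X g (l ⊕ h) ≡ true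
      to-lh h∈Xg = l∈R g h h∈Xg (S-false-classwise h₀∈Xg h₀∉S h∈Xg)

  -- With g₂ outer and g₂⁻ representing the inverse basic set, the structure constant
  -- #{u ~ g₂⁻ | u⁻¹ z ~ g₂} of A is maximal at a lift z of x, hence (being constant on basic
  -- sets) also at a lift of y; the term u = (h , 0) then gives y ⊕ h ∈ X g₂.
  inOuterRadical-classwise : ∀ {g x y} → X g x ≡ true → X g y ≡ true → InOuterRadical x → InOuterRadical y
  inOuterRadical-classwise {g} {x} {y} x∈Xg y∈Xg x∈R g₂ h h∈Xg₂ h∉S
    with quotSet⁻ (_~ g) x∈Xg | quotSet⁻ (_~ g) y∈Xg | inv-closed g₂
  ... | a , xa~g | b , yb~g | g₂⁻ , inv~g₂⇔~g₂⁻ =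
    subst (λ z → X g₂ z ≡ true) (⊕ᵥ-comm h y) (quotSet⁺ (_~ g₂) _ u₀⁻¹yb~g₂)
    where
      moves-xa : ∀ u → u ~ g₂⁻ ≡ true → (inv p u ∙ (x , a)) ~ g₂ ≡ true
      moves-xa (hᵤ , cᵤ) u~g₂⁻ =
        subst (λ z → (z , _) ~ g₂ ≡ true) (⊕ᵥ-comm x hᵤ)
          (outer-lift h∈Xg₂ h∉S (x∈R g₂ hᵤ hᵤ∈Xg₂ (S-false-classwise h∈Xg₂ h∉S hᵤ∈Xg₂)) _)
        where
          hᵤ∈Xg₂ : X g₂ hᵤ ≡ true
          hᵤ∈Xg₂ = quotSet⁺ (_~ g₂) _ (trans (inv~g₂⇔~g₂⁻ (hᵤ , cᵤ)) u~g₂⁻)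

      constant-at-yb : structConst p _~_ g₂⁻ g₂ (y , b) ≡ countG p (_~ g₂⁻)
      constant-at-yb = begin
        structConst p _~_ g₂⁻ g₂ (y , b) ≡⟨ mult-closed g₂⁻ g₂ (x , a) (y , b) (~-trans _ g _ xa~g (~-sym _ _ yb~g)) ⟨
        structConst p _~_ g₂⁻ g₂ (x , a) ≡⟨ count-∧-≡ (allG p) (_~ g₂⁻) _ moves-xa ⟩
        countG p (_~ g₂⁻)                ∎
        where open ≡-Reasoning

      u₀ : G p
      u₀ = h , 0ₚ p

      u₀~g₂⁻ : u₀ ~ g₂⁻ ≡ true
      u₀~g₂⁻ = trans (sym (inv~g₂⇔~g₂⁻ u₀)) (outer-lift h∈Xg₂ h∉S h∈Xg₂ _)

      u₀⁻¹yb~g₂ : (inv p u₀ ∙ (y , b)) ~ g₂ ≡ true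
      u₀⁻¹yb~g₂ = count-∧-≡⁻ (allG p) (_~ g₂⁻) _ constant-at-yb (∈-allG p u₀) u₀~g₂⁻

  outerRadical-classwise : ∀ {g x y} → X g x ≡ true → X g y ≡ true → outerRadical x ≡ true → outerRadical y ≡ true
  outerRadical-classwise x∈Xg y∈Xg x∈L with outerRadical⁻ x∈L
  ... | x∈S , x∈R = outerRadical⁺ (S-classwise x∈Xg y∈Xg x∈S) (inOuterRadical-classwise x∈Xg y∈Xg x∈R)

  outerRadical-isBSubgroup : IsBSubgroup p _~_ outerRadical
  outerRadical-isBSubgroup = record
    { 0∈       = outerRadical⁺ S-0 inOuterRadical-0
    ; ⊕-closed = λ v w v∈L w∈L →
        let v∈S , v∈R = outerRadical⁻ v∈L
            w∈S , w∈R = outerRadical⁻ w∈L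
        in outerRadical⁺ (S-closed v∈S w∈S) (inOuterRadical-⊕ v∈R w∈R)
    ; union    = λ g x y x∈Xg y∈Xg →
        ⇔→≡ (mk⇔ (outerRadical-classwise x∈Xg y∈Xg) (outerRadical-classwise y∈Xg x∈Xg))
    }

  gwr-complement : ∀ {t} → outerRadical t ≡ true → isZero t ≡ false → HasGwrComplement p _~_ S
  gwr-complement {t} t∈L t≢0 =
    outerRadical , outerRadical-isBSubgroup , (t , t∈L , t≢0) , (λ h h∈L → proj₁ (outerRadical⁻ h∈L)) , invariant
    where
      invariant : ∀ g → ∃[ h₀ ] (X g h₀ ≡ true × S h₀ ≡ false) → ∀ l → outerRadical l ≡ true → ∀ h →
                  (X g (l ⊕ h) ≡ X g h) × (X g (h ⊕ l) ≡ X g h)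
      invariant g (h₀ , h₀∈Xg , h₀∉S) l l∈L h =
        let l⊕h≈h = inOuterRadical-invariant (proj₂ (outerRadical⁻ l∈L)) h₀∈Xg h₀∉S h
        in l⊕h≈h , trans (cong (X g) (⊕ᵥ-comm h l)) l⊕h≈h

  module AutBProperties (f : AutB p _~_) where
    open AutB f

    to-0H : to 0H ≡ 0H
    to-0H = begin
      to 0H                      ≡⟨ ⊕ᵥ-cancelˡ (to 0H) (to 0H) ⟨
      to 0H ⊕ (to 0H ⊕ to 0H)    ≡⟨ cong (to 0H ⊕_) (hom 0H 0H) ⟨
      to 0H ⊕ to (0H ⊕ 0H)       ≡⟨ ⊕ᵥ-self (to 0H) ⟩
      0H                         ∎
      where open ≡-Reasoning

    to-preserves-X : ∀ {g x} → X g x ≡ true → X g (to x) ≡ true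
    to-preserves-X {g} {x} x∈Xg with proj₁ (presR g 0H x) (x , x∈Xg , sym (⊕ᵥ-identityʳ x))
    ... | y , y∈Xg , tox≡y⊕to0 =
      subst (λ z → X g z ≡ true) (sym (trans tox≡y⊕to0 (trans (cong (y ⊕_) to-0H) (⊕ᵥ-identityʳ y)))) y∈Xg

    to-reflects-X : ∀ {g x} → X g (to x) ≡ true → X g x ≡ true
    to-reflects-X {g} {x} tox∈Xg
      with proj₂ (presR g 0H x) (to x , tox∈Xg , sym (trans (cong (to x ⊕_) to-0H) (⊕ᵥ-identityʳ (to x))))
    ... | y , y∈Xg , x≡y⊕0 = subst (λ z → X g z ≡ true) (sym (trans x≡y⊕0 (⊕ᵥ-identityʳ y))) y∈Xg

    to-preserves-S : ∀ h → S (to h) ≡ S h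
    to-preserves-S h = ⇔→≡ (mk⇔ reflect preserve)
      where
        reflect : S (to h) ≡ true → S h ≡ true
        reflect toh∈S with quotSet⁻ U toh∈S
        ... | a , _ = S-classwise (own-class (to h) a) (to-reflects-X (own-class (to h) a)) toh∈S
        preserve : S h ≡ true → S (to h) ≡ true
        preserve h∈S with quotSet⁻ U h∈S
        ... | a , _ = S-classwise (own-class h a) (to-preserves-X (own-class h a)) h∈S

  module _ (S-large : length allH < 3 * countH S) where

    S-index-two : ∀ {a b} → S a ≡ false → S b ≡ false → S (a ⊕ b) ≡ true
    S-index-two = index-two S S-closed S-large

    module _ (f f′ : AutB p _~_) (agree : ∀ x → S x ≡ true → AutB.to f x ≡ AutB.to f′ x) where
      open AutB f using () renaming (to to F)
      open AutB f′ using () renaming (to to F′; from to F′⁻¹)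
      open AutBProperties

      difference-outside-S : ∀ {x k} → S x ≡ false → S k ≡ false → F k ⊕ F′ k ≡ F x ⊕ F′ x
      difference-outside-S {x} {k} x∉S k∉S = begin
        F k ⊕ F′ k                   ≡⟨ cong (λ z → F z ⊕ F′ z) (⊕ᵥ-cancelˡ x k) ⟨
        F (x ⊕ s) ⊕ F′ (x ⊕ s)       ≡⟨ cong₂ _⊕_ (AutB.hom f x s) (AutB.hom f′ x s) ⟩
        (F x ⊕ F s) ⊕ (F′ x ⊕ F′ s)  ≡⟨ cong (λ z → (F x ⊕ z) ⊕ (F′ x ⊕ F′ s)) (agree s (S-index-two x∉S k∉S)) ⟩
        (F x ⊕ F′ s) ⊕ (F′ x ⊕ F′ s) ≡⟨ ⊕ᵥ-cancel-shared (F x) (F′ x) (F′ s) ⟩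
        F x ⊕ F′ x                   ∎
        where
          open ≡-Reasoning
          s = x ⊕ k

      difference-in-outerRadical : ∀ {x} → S x ≡ false → outerRadical (F x ⊕ F′ x) ≡ true
      difference-in-outerRadical {x} x∉S = outerRadical⁺ (S-index-two (outside f) (outside f′)) translates
        where
          outside : ∀ f″ → S (AutB.to f″ x) ≡ false
          outside f″ = trans (to-preserves-S f″ x) x∉S

          translates : InOuterRadical (F x ⊕ F′ x)
          translates g h h∈Xg h∉S = subst (λ z → X g z ≡ true) Fk≡t⊕h (to-preserves-X f k∈Xg)
            where
              k = F′⁻¹ h
              F′k≡h : F′ k ≡ h
              F′k≡h = Inverse.strictlyInverseˡ (AutB.σ f′) h
              k∈Xg : X g k ≡ true
              k∈Xg = to-reflects-X f′ (subst (λ z → X g z ≡ true) (sym F′k≡h) h∈Xg)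
              k∉S : S k ≡ false
              k∉S = trans (sym (to-preserves-S f′ k)) (trans (cong S F′k≡h) h∉S)
              Fk≡t⊕h : F k ≡ (F x ⊕ F′ x) ⊕ h
              Fk≡t⊕h = trans (sym (⊕ᵥ-cancelʳ (F′ k) (F k))) (cong₂ _⊕_ (difference-outside-S x∉S k∉S) F′k≡h)

      agree-everywhere : ¬ HasGwrComplement p _~_ S → ∀ x → F x ≡ F′ x
      agree-everywhere no-gwr x with S x in x∈S
      ... | true  = agree x x∈S
      ... | false with isZero (F x ⊕ F′ x) in t≡0
      ...   | true  = ⊕ᵥ-≡0⇒≡ (F x) (F′ x) (isZero⇒≡0 _ t≡0)
      ...   | false = ⊥-elim (no-gwr (gwr-complement (difference-in-outerRadical x∈S) t≡0))

    restriction-bijection : ¬ HasGwrComplement p _~_ S → Bijection (AutBRestrSetoid p _~_ S) (AutBSetoid p _~_)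
    restriction-bijection no-gwr = record
      { to        = proj₁
      ; cong      = λ {f} {f′} agree → agree-everywhere (proj₁ f) (proj₁ f′) agree no-gwr
      ; bijective = (λ f≈f′ x _ → f≈f′ x)
                  , λ f → (f , AutBProperties.to-preserves-S f) , λ {f′} agree → agree-everywhere (proj₁ f′) f agree no-gwr
      }

lemma9p4 : (p : ℕ) .{{_ : NonZero p}} → Prime p →
    (_~_ : G p → G p → Bool) → IsSRing p _~_ →
    (U : G p → Bool) → IsASubgroup p _~_ U →
    (∀ g → Pset p g ≡ true → U g ≡ true) →
    IsASubgroup p _~_ (Pset p) →
    IsWreath p _~_ U (Pset p) →
    (∃[ g ] (Pset p g ≡ true × g ≢ e p)) →
    (∃[ g ] (U g ≡ false)) →
    countH (quotSet p _~_ U) ≡ 16 →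
    Is2SRing p _~_ →
    ¬ HasGwrComplement p _~_ (quotSet p _~_ U) →
    Bijection (AutBRestrSetoid p _~_ (quotSet p _~_ U)) (AutBSetoid p _~_)
lemma9p4 p _ _~_ isSRing U U-sub P⊆U _ wreath _ _ |S|≡16 _ no-gwr =
  WreathQuotient.restriction-bijection p _~_ isSRing U U-sub P⊆U wreath S-large no-gwr
  where
    S-large : length allH < 3 * countH (quotSet p _~_ U)
    S-large = subst (λ c → length allH < 3 * c) (sym |S|≡16) (from-yes (32 <? 48))
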